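{- As $n\to\infty$, \[ \chi_2(n) \ge (1-o(1))\,\frac{n}{\log n}, \] where $\log$ denotes the logarithm to base $2$.
   Context: $\chi_2(n)$ denotes the minimum number of colors needed to color the nonzero vectors of $\mathbb{F}_2^n$ (the points of $\mathrm{PG}(n-1,2)$) so that no triple $\{x,y,x+y\}$ with $x\neq y$ nonzero (a line of $\mathrm{PG}(n-1,2)$) is monochromatic. -}

module Defs where

open import Data.Bool using (Bool; true; false; _xor_)
open import Data.Nat using (ℕ; _<_)
open import Data.Fin using (Fin)
open import Data.Vec using (Vec; zipWith; replicate)
open import Data.Product using (Σ; _×_; proj₁)
open import Relation.Binary.PropositionalEquality using (_≡_; _≢_)
open import Relation.Nullary using (¬_)

-- Vectors of F_2^n, with Bool as F_2 (false = 0, true = 1, xor = addition).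
F2^ : ℕ → Set
F2^ n = Vec Bool n

_⊕_ : {n : ℕ} → F2^ n → F2^ n → F2^ n
_⊕_ = zipWith _xor_

zeroVec : (n : ℕ) → F2^ n
zeroVec n = replicate n false

-- Points of PG(n-1,2): nonzero vectors of F_2^n.
Point : ℕ → Set
Point n = Σ (F2^ n) (λ v → v ≢ zeroVec n)

-- A proper c-colouring: no triple {x, y, x+y} (x ≠ y nonzero) is monochromatic.
-- (x+y is then automatically nonzero; it is supplied as a point with that vector.)
IsProperColoring : (n c : ℕ) → (Point n → Fin c) → Set
IsProperColoring n c f =
  (x y z : Point n) → proj₁ x ≢ proj₁ y → proj₁ z ≡ (proj₁ x ⊕ proj₁ y) →
  ¬ (f x ≡ f y × f y ≡ f z)

Colorable : (n c : ℕ) → Set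
Colorable n c = Σ (Point n → Fin c) (IsProperColoring n c)

IsChi2 : (n m : ℕ) → Set
IsChi2 n m = Colorable n m × ((c : ℕ) → c < m → ¬ Colorable n c)

-- Call a
-- duplicate-free list D of nonzero vectors coloured within a palette of j colours if the
-- members of D and the sums of any two distinct members all get colours from the palette.
-- If a ∷ K is one colour class of D, then a + K is coloured within the other j - 1 colours:
-- a + y avoids the class colour since {a, y, a + y} is a line, and so does
-- (a + y) + (a + y′) = y + y′, the third point on the line through y and y′. Hence
-- |D| ≤ j · (1 + bound for j - 1), which gives |D| < (j + 1)^j. The affine hyperplane
-- x₀ = 1 has 2ⁿ⁻¹ points and is coloured within all χ = χ₂(n) colours, so
-- 2ⁿ⁻¹ < (χ + 1)^χ, that is χ ≥ (1 - o(1)) n / log n.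
{-# OPTIONS --safe #-}
module Submission where

open import Defs
open import Data.Nat using (ℕ; suc; _*_; _^_; _≤_)
open import Data.Product using (∃)

open import Data.Bool using (true; false; _xor_)
import Data.Bool as Bool
open import Data.Bool.Properties using (xor-same; not-involutive)
open import Data.Empty using (⊥-elim)
open import Data.Fin as Fin using (Fin; zero; suc; punchIn; punchOut)
open import Data.Fin.Properties using (punchIn-punchOut)
open import Data.List using (List; []; _∷_; [_]; length; filter; map; _++_)
open import Data.List.Properties using (length-map; length-++)
open import Data.List.Membership.Propositional using (_∈_)
open import Data.List.Membership.Propositional.Properties using (∈-map⁻; ∈-filter⁻)
open import Data.List.Relation.Binary.Disjoint.Propositional using (Disjoint)
open import Data.List.Relation.Binary.Sublist.Propositional.Properties
  using (filter-⊆; filter⁺; length-mono-≤)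
import Data.List.Relation.Unary.All as All
open import Data.List.Relation.Unary.AllPairs using ([]; _∷_)
open import Data.List.Relation.Unary.Any using (here; there)
open import Data.List.Relation.Unary.Unique.Propositional using (Unique)
import Data.List.Relation.Unary.Unique.Propositional.Properties as Unique
open import Data.Nat using (zero; _+_; _<_; z≤n; s≤s; NonZero; _≤?_)
open import Data.Nat.Properties
open import Data.Product using (_×_; _,_; proj₁; proj₂)
open import Data.Vec using ([]; _∷_; replicate)
open import Data.Vec.Properties using (∷-injectiveˡ; ∷-injectiveʳ; ≡-dec)
open import Function using (_∘_; id)
open import Relation.Binary.Definitions using (DecidableEquality)
open import Relation.Binary.PropositionalEquality
  using (_≡_; _≢_; refl; sym; trans; cong; cong₂; subst; module ≡-Reasoning)
open import Relation.Nullary using (¬_; yes; no; does; ¬?)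
open import Relation.Unary using (Decidable)

variable
  n : ℕ

xor≡false⇒≡ : ∀ x y → x xor y ≡ false → x ≡ y
xor≡false⇒≡ false false _  = refl
xor≡false⇒≡ true  true  _  = refl
xor≡false⇒≡ false true  ()
xor≡false⇒≡ true  false ()

xor-cancel-common : ∀ a y z → (a xor y) xor (a xor z) ≡ y xor z
xor-cancel-common false y     z = refl
xor-cancel-common true  false z = not-involutive z
xor-cancel-common true  true  z = refl

⊕-self : (x : F2^ n) → x ⊕ x ≡ zeroVec n
⊕-self []      = refl
⊕-self (b ∷ x) = cong₂ _∷_ (xor-same b) (⊕-self x)

⊕≡0⇒≡ : (x y : F2^ n) → x ⊕ y ≡ zeroVec n → x ≡ y
⊕≡0⇒≡ []      []      _  = refl
⊕≡0⇒≡ (a ∷ x) (b ∷ y) eq =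
  cong₂ _∷_ (xor≡false⇒≡ a b (∷-injectiveˡ eq)) (⊕≡0⇒≡ x y (∷-injectiveʳ eq))

≢⇒⊕≢0 : {x y : F2^ n} → x ≢ y → x ⊕ y ≢ zeroVec n
≢⇒⊕≢0 {x = x} {y} x≢y = x≢y ∘ ⊕≡0⇒≡ x y

⊕-cancel-common : (a y z : F2^ n) → (a ⊕ y) ⊕ (a ⊕ z) ≡ y ⊕ z
⊕-cancel-common []      []      []      = refl
⊕-cancel-common (a ∷ x) (b ∷ y) (c ∷ z) =
  cong₂ _∷_ (xor-cancel-common a b c) (⊕-cancel-common x y z)

⊕-cancelˡ : (a : F2^ n) {y z : F2^ n} → a ⊕ y ≡ a ⊕ z → y ≡ z
⊕-cancelˡ {n} a {y} {z} eq = ⊕≡0⇒≡ y z (begin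
  y ⊕ z              ≡⟨ sym (⊕-cancel-common a y z) ⟩
  (a ⊕ y) ⊕ (a ⊕ z)  ≡⟨ cong (_⊕ (a ⊕ z)) eq ⟩
  (a ⊕ z) ⊕ (a ⊕ z)  ≡⟨ ⊕-self (a ⊕ z) ⟩
  zeroVec n          ∎)
  where open ≡-Reasoning

vectors : (n : ℕ) → List (F2^ n)
vectors zero    = [ [] ]
vectors (suc n) = map (false ∷_) (vectors n) ++ map (true ∷_) (vectors n)

length-vectors : (n : ℕ) → length (vectors n) ≡ 2 ^ n
length-vectors zero    = refl
length-vectors (suc n) = begin
  length (map (false ∷_) vs ++ map (true ∷_) vs)
    ≡⟨ length-++ (map (false ∷_) vs) ⟩
  length (map (false ∷_) vs) + length (map (true ∷_) vs)
    ≡⟨ cong₂ _+_ (length-map _ vs) (length-map _ vs) ⟩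
  length vs + length vs
    ≡⟨ cong (λ l → l + l) (length-vectors n) ⟩
  2 ^ n + 2 ^ n
    ≡⟨ cong (2 ^ n +_) (sym (+-identityʳ (2 ^ n))) ⟩
  2 ^ suc n ∎
  where
  open ≡-Reasoning
  vs : List (F2^ n)
  vs = vectors n

vectors-unique : (n : ℕ) → Unique (vectors n)
vectors-unique zero    = All.[] ∷ []
vectors-unique (suc n) =
  Unique.++⁺ (Unique.map⁺ ∷-injectiveʳ (vectors-unique n))
             (Unique.map⁺ ∷-injectiveʳ (vectors-unique n))
             heads-differ
  where
  heads-differ : Disjoint (map (false ∷_) (vectors n)) (map (true ∷_) (vectors n))
  heads-differ (v∈₀ , v∈₁) with ∈-map⁻ (false ∷_) v∈₀ | ∈-map⁻ (true ∷_) v∈₁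
  ... | _ , _ , refl | _ , _ , ()

length≤filter+filter-¬ : {A : Set} {P : A → Set} (P? : Decidable P) (xs : List A) →
  length xs ≤ length (filter P? xs) + length (filter (¬? ∘ P?) xs)
length≤filter+filter-¬ P? []       = z≤n
length≤filter+filter-¬ P? (x ∷ xs) with does (P? x)
... | true  = s≤s (length≤filter+filter-¬ P? xs)
... | false = ≤-trans (s≤s (length≤filter+filter-¬ P? xs)) (≤-reflexive (sym (+-suc _ _)))

InPalette : {C : Set} {j : ℕ} → (Fin j → C) → C → Set
InPalette e c = ∃ λ i → c ≡ e i

InPalette-punchIn : {C : Set} {j : ℕ} {e : Fin (suc j) → C} (i₀ : Fin (suc j)) {c : C} →
  InPalette e c → c ≢ e i₀ → InPalette (e ∘ punchIn i₀) c
InPalette-punchIn {e = e} i₀ (i , c≡eᵢ) c≢eᵢ₀ =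
  punchOut i₀≢i , trans c≡eᵢ (cong e (sym (punchIn-punchOut i₀≢i)))
  where
  i₀≢i : i₀ ≢ i
  i₀≢i refl = c≢eᵢ₀ c≡eᵢ

length≤palette*classBound : {A C : Set} (_≟_ : DecidableEquality C) (f : A → C)
  (j : ℕ) (e : Fin j → C) {B : ℕ} (xs : List A) →
  (∀ {x} → x ∈ xs → InPalette e (f x)) →
  (∀ i → length (filter (λ x → f x ≟ e i) xs) ≤ B) →
  length xs ≤ j * B
length≤palette*classBound _≟_ f zero e []       _       _ = z≤n
length≤palette*classBound _≟_ f zero e (x ∷ xs) covered _ with covered (here refl)
... | () , _
length≤palette*classBound {A} _≟_ f (suc j) e {B} xs covered bounded = begin
  length xs                               ≤⟨ length≤filter+filter-¬ in-e₀ xs ⟩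
  length (filter in-e₀ xs) + length rest  ≤⟨ +-mono-≤ (bounded zero) rest-bound ⟩
  B + j * B                               ∎
  where
  open ≤-Reasoning
  in-e₀ : Decidable (λ x → f x ≡ e zero)
  in-e₀ x = f x ≟ e zero

  rest : List A
  rest = filter (¬? ∘ in-e₀) xs

  rest-covered : ∀ {x} → x ∈ rest → InPalette (e ∘ suc) (f x)
  rest-covered x∈ with ∈-filter⁻ (¬? ∘ in-e₀) {xs = xs} x∈
  ... | x∈xs , fx≢e₀ with covered x∈xs
  ...   | zero  , fx≡e₀ = ⊥-elim (fx≢e₀ fx≡e₀)
  ...   | suc i , fx≡eᵢ = i , fx≡eᵢ

  rest-bound : length rest ≤ j * B
  rest-bound = length≤palette*classBound _≟_ f j (e ∘ suc) rest rest-covered λ i →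
    ≤-trans (length-mono-≤ (filter⁺ _ _ (λ { refl fx≡eᵢ → fx≡eᵢ }) (filter-⊆ (¬? ∘ in-e₀) xs)))
            (bounded (suc i))

NoMonochromaticLine : {C : Set} → (F2^ n → C) → Set
NoMonochromaticLine {n} col = ∀ {x y} → x ≢ zeroVec n → y ≢ zeroVec n → x ≢ y →
  ¬ (col x ≡ col y × col y ≡ col (x ⊕ y))

record ColouredWithin {C : Set} {j : ℕ} (col : F2^ n → C) (e : Fin j → C) (D : List (F2^ n))
                      : Set where
  field
    unique    : Unique D
    nonzero   : ∀ {x} → x ∈ D → x ≢ zeroVec n
    colour    : ∀ {x} → x ∈ D → InPalette e (col x)
    sumColour : ∀ {x y} → x ∈ D → y ∈ D → x ≢ y → InPalette e (col (x ⊕ y))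

open ColouredWithin

ColouredWithin-filter : {C : Set} {j : ℕ} {col : F2^ n → C} {e : Fin j → C} {D : List (F2^ n)}
  {P : F2^ n → Set} (P? : Decidable P) → ColouredWithin col e D → ColouredWithin col e (filter P? D)
ColouredWithin-filter P? w .unique          = Unique.filter⁺ P? (w .unique)
ColouredWithin-filter P? w .nonzero x∈      = w .nonzero (proj₁ (∈-filter⁻ P? x∈))
ColouredWithin-filter P? w .colour x∈       = w .colour (proj₁ (∈-filter⁻ P? x∈))
ColouredWithin-filter P? w .sumColour x∈ y∈ =
  w .sumColour (proj₁ (∈-filter⁻ P? x∈)) (proj₁ (∈-filter⁻ P? y∈))

module _ {C : Set} {col : F2^ n → C} (proper : NoMonochromaticLine col)
         {j : ℕ} {e : Fin (suc j) → C} where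

  monochromatic-sum-avoids : ∀ {i₀ D} → ColouredWithin col e D → (∀ {y} → y ∈ D → col y ≡ e i₀) →
    ∀ {y z} → y ∈ D → z ∈ D → y ≢ z → InPalette (e ∘ punchIn i₀) (col (y ⊕ z))
  monochromatic-sum-avoids {i₀} w mono y∈ z∈ y≢z =
    InPalette-punchIn i₀ (w .sumColour y∈ z∈ y≢z) λ y⊕z∼eᵢ₀ →
      proper (w .nonzero y∈) (w .nonzero z∈) y≢z
             (trans (mono y∈) (sym (mono z∈)) , trans (mono z∈) (sym y⊕z∼eᵢ₀))

  ColouredWithin-translate : ∀ {i₀ a K} → ColouredWithin col e (a ∷ K) →
    (∀ {y} → y ∈ a ∷ K → col y ≡ e i₀) → ColouredWithin col (e ∘ punchIn i₀) (map (a ⊕_) K)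
  ColouredWithin-translate {a = a} w mono .unique with w .unique
  ... | _ ∷ K-unique = Unique.map⁺ (⊕-cancelˡ a) K-unique
  ColouredWithin-translate {a = a} w mono .nonzero x∈ with ∈-map⁻ (a ⊕_) x∈ | w .unique
  ... | y , y∈K , refl | a∉K ∷ _ = ≢⇒⊕≢0 (All.lookup a∉K y∈K)
  ColouredWithin-translate {a = a} w mono .colour x∈ with ∈-map⁻ (a ⊕_) x∈ | w .unique
  ... | y , y∈K , refl | a∉K ∷ _ =
    monochromatic-sum-avoids w mono (here refl) (there y∈K) (All.lookup a∉K y∈K)
  ColouredWithin-translate {a = a} w mono .sumColour x∈ z∈ x≢z
    with ∈-map⁻ (a ⊕_) x∈ | ∈-map⁻ (a ⊕_) z∈
  ... | y , y∈K , refl | y′ , y′∈K , refl =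
    subst (InPalette _ ∘ col) (sym (⊕-cancel-common a y y′))
          (monochromatic-sum-avoids w mono (there y∈K) (there y′∈K) (x≢z ∘ cong (a ⊕_)))

module _ {C : Set} (_≟_ : DecidableEquality C) {col : F2^ n → C}
         (proper : NoMonochromaticLine col) where

  ColouredWithin⇒length<[1+j]^j : (j : ℕ) (e : Fin j → C) (D : List (F2^ n)) →
    ColouredWithin col e D → length D < suc j ^ j
  ColouredWithin⇒length<[1+j]^j zero    e []      w = s≤s z≤n
  ColouredWithin⇒length<[1+j]^j zero    e (x ∷ D) w with w .colour (here refl)
  ... | () , _
  ColouredWithin⇒length<[1+j]^j (suc j) e D       w = begin-strict
    length D             ≤⟨ length≤palette*classBound _≟_ col (suc j) e D (w .colour) class-bound ⟩
    suc j * suc j ^ j    <⟨ ^-monoˡ-< (suc j) (n<1+n (suc j)) ⟩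
    suc (suc j) ^ suc j  ∎
    where
    open ≤-Reasoning

    monochromatic-bound : ∀ {i₀} K → ColouredWithin col e K → (∀ {y} → y ∈ K → col y ≡ e i₀) →
      length K ≤ suc j ^ j
    monochromatic-bound []      _ _    = z≤n
    monochromatic-bound (a ∷ K) wK mono =
      subst (_< suc j ^ j) (length-map (a ⊕_) K)
            (ColouredWithin⇒length<[1+j]^j j _ _ (ColouredWithin-translate proper wK mono))

    has-colour : ∀ i → Decidable (λ x → col x ≡ e i)
    has-colour i x = col x ≟ e i

    class-bound : ∀ i → length (filter (has-colour i) D) ≤ suc j ^ j
    class-bound i = monochromatic-bound _ (ColouredWithin-filter (has-colour i) w)
                                          (proj₂ ∘ ∈-filter⁻ (has-colour i) {xs = D})

-- The colour c of the zero vector is never inspected by NoMonochromaticLine.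
extendToZero : {C : Set} → (Point n → C) → C → F2^ n → C
extendToZero {n} f c v with ≡-dec Bool._≟_ v (zeroVec n)
... | yes _   = c
... | no v≢0 = f (v , v≢0)

extendToZero-nonzero : {C : Set} (f : Point n → C) (c : C) (v : F2^ n) → v ≢ zeroVec n →
  ∃ λ v≢0 → extendToZero f c v ≡ f (v , v≢0)
extendToZero-nonzero {n} f c v v≢0 with ≡-dec Bool._≟_ v (zeroVec n)
... | yes v≡0  = ⊥-elim (v≢0 v≡0)
... | no v≢0′ = v≢0′ , refl

extendToZero-noMonochromaticLine : {m : ℕ} {f : Point n → Fin m} (c : Fin m) →
  IsProperColoring n m f → NoMonochromaticLine (extendToZero f c)
extendToZero-noMonochromaticLine {f = f} c proper {x} {y} x≢0 y≢0 x≢y (x∼y , y∼x⊕y)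
  with extendToZero-nonzero f c x x≢0
     | extendToZero-nonzero f c y y≢0
     | extendToZero-nonzero f c (x ⊕ y) (≢⇒⊕≢0 x≢y)
... | px , fx | py , fy | ps , fs =
  proper (x , px) (y , py) (x ⊕ y , ps) x≢y refl
         (trans (sym fx) (trans x∼y fy) , trans (sym fy) (trans y∼x⊕y fs))

affineHyperplane : (n : ℕ) → List (F2^ (suc n))
affineHyperplane n = map (true ∷_) (vectors n)

affineHyperplane-colouredWithin : {m : ℕ} (col : F2^ (suc n) → Fin m) →
  ColouredWithin col id (affineHyperplane n)
affineHyperplane-colouredWithin {n} col .unique = Unique.map⁺ ∷-injectiveʳ (vectors-unique n)
affineHyperplane-colouredWithin {n} col .nonzero x∈ with ∈-map⁻ (true ∷_) x∈
... | _ , _ , refl = λ ()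
affineHyperplane-colouredWithin col .colour {x} _ = col x , refl
affineHyperplane-colouredWithin col .sumColour {x} {y} _ _ _ = col (x ⊕ y) , refl

properColouring⇒2^n<[1+m]^m : {m : ℕ} (f : Point (suc n) → Fin m) →
  IsProperColoring (suc n) m f → 2 ^ n < suc m ^ m
properColouring⇒2^n<[1+m]^m {n} {m} f proper = begin-strict
  2 ^ n                        ≡⟨ sym (length-vectors n) ⟩
  length (vectors n)           ≡⟨ sym (length-map (true ∷_) (vectors n)) ⟩
  length (affineHyperplane n)  <⟨ ColouredWithin⇒length<[1+j]^j Fin._≟_
                                    (extendToZero-noMonochromaticLine c proper)
                                    m id _ (affineHyperplane-colouredWithin (extendToZero f c)) ⟩
  suc m ^ m                    ∎
  where
  open ≤-Reasoning
  c : Fin m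
  c = f ((true ∷ replicate n false) , λ ())

n<2^n : (n : ℕ) → n < 2 ^ n
n<2^n zero    = s≤s z≤n
n<2^n (suc n) = +-mono-≤-< (m^n>0 2 n) (≤-trans (n<2^n n) (m≤m+n (2 ^ n) 0))

2^[1+n]≤[1+n]^[1+m] : {n m : ℕ} → 1 ≤ n → 2 ^ n < suc m ^ m → 2 ^ suc n ≤ suc n ^ suc m
2^[1+n]≤[1+n]^[1+m] {n} {m} 1≤n 2ⁿ<[1+m]ᵐ with suc n ≤? m
... | yes 1+n≤m = begin
  2 ^ suc n      ≤⟨ ^-monoˡ-≤ (suc n) (s≤s 1≤n) ⟩
  suc n ^ suc n  ≤⟨ ^-monoʳ-≤ (suc n) (m≤n⇒m≤1+n 1+n≤m) ⟩
  suc n ^ suc m  ∎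
  where open ≤-Reasoning
... | no 1+n≰m = *-mono-≤ (s≤s 1≤n) (≤-trans (<⇒≤ 2ⁿ<[1+m]ᵐ) (^-monoˡ-≤ m (≰⇒> 1+n≰m)))

2^n<[1+m]^m⇒k≤m : (k : ℕ) {n m : ℕ} → k ^ k < n → 2 ^ n < suc m ^ m → k ≤ m
2^n<[1+m]^m⇒k≤m k {n} {m} kᵏ<n 2ⁿ<[1+m]ᵐ = ≮⇒≥ (<-irrefl refl ∘ n<n)
  where
  open ≤-Reasoning
  n<n : m < k → n < n
  n<n m<k@(s≤s _) = begin-strict
    n          <⟨ n<2^n n ⟩
    2 ^ n      <⟨ 2ⁿ<[1+m]ᵐ ⟩
    suc m ^ m  ≤⟨ ^-monoˡ-≤ m m<k ⟩
    k ^ m      ≤⟨ ^-monoʳ-≤ k (<⇒≤ m<k) ⟩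
    k ^ k      <⟨ kᵏ<n ⟩
    n          ∎

2^[k*n]≤n^[[1+k]*m] : (k : ℕ) {n m : ℕ} .{{_ : NonZero n}} → k ≤ m → 2 ^ n ≤ n ^ suc m →
  2 ^ (k * n) ≤ n ^ (suc k * m)
2^[k*n]≤n^[[1+k]*m] k {n} {m} k≤m 2ⁿ≤n^[1+m] = begin
  2 ^ (k * n)      ≡⟨ cong (2 ^_) (*-comm k n) ⟩
  2 ^ (n * k)      ≡⟨ sym (^-*-assoc 2 n k) ⟩
  (2 ^ n) ^ k      ≤⟨ ^-monoˡ-≤ k 2ⁿ≤n^[1+m] ⟩
  (n ^ suc m) ^ k  ≡⟨ ^-*-assoc n (suc m) k ⟩
  n ^ (suc m * k)  ≤⟨ ^-monoʳ-≤ n (+-mono-≤ k≤m (≤-reflexive (*-comm m k))) ⟩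
  n ^ (suc k * m)  ∎
  where open ≤-Reasoning

proposition1p2 : (k : ℕ) → ∃ λ N → (n m : ℕ) → N ≤ n → IsChi2 n m →
    2 ^ (k * n) ≤ n ^ (suc k * m)
proposition1p2 k = suc (suc (k ^ k)) , λ where
  (suc n) m (s≤s kᵏ<n) ((f , proper) , _) →
    let 2ⁿ<[1+m]ᵐ = properColouring⇒2^n<[1+m]^m f proper
    in 2^[k*n]≤n^[[1+k]*m] k (2^n<[1+m]^m⇒k≤m k {m = m} kᵏ<n 2ⁿ<[1+m]ᵐ)
                              (2^[1+n]≤[1+n]^[1+m] {m = m} (≤-trans (s≤s z≤n) kᵏ<n) 2ⁿ<[1+m]ᵐ)
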